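{- Let $a$, $b$, $d$ be positive integers with $d$ not a perfect square, put $\alpha=a+b^{2}\sqrt{d}$ and $N_{\alpha}=a^{2}-b^{4}d$. Let $\varepsilon=(t+u\sqrt{d})/2$ be a unit in the ring of integers of $\mathbb{Q}(\sqrt{d})$ with $t,u$ positive integers, and define $(x_k)$, $(y_k)$ by $x_k+y_k\sqrt{d}=\alpha\varepsilon^{2k}$. Suppose $k\neq0$, $N_{\alpha}<0$, and that $x_k$ and $y_k$ are both integers. Put $t'=\operatorname{core}(N_{\alpha})$, $u_1=2x_k$, $u_2=\pm 2\sqrt{N_{\alpha}/\operatorname{core}(N_{\alpha})}$, and define \[ g_1=\gcd(u_1,u_2),\quad g_2=\gcd(u_1/g_1,t'),\quad g_3=\begin{cases}1&\text{if } t'\equiv1\pmod 4 \text{ and } (u_1-u_2)/g_1\equiv0\pmod 2,\\ 2&\text{if } t'\equiv3\pmod 4 \text{ and } (u_1-u_2)/g_1\equiv0\pmod 2,\\ 4&\text{otherwise,}\end{cases} \] $g=g_1\sqrt{g_2/g_3}$, $d'=u_2^{2}t'/g^{2}$, and \[ \mathcal{N}_{d',4}=\prod_{p\mid 4}p^{\min\left(v_p(d')/2,\ v_p(4)+1/(p-1)\right)}=2^{\min(v_2(d')/2,\,3)}. \] Then \[ 2\leq |g|\,\mathcal{N}_{d',4}\leq 2\sqrt{|N_{\alpha}|}. \]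
   Context: For a nonzero integer $n$, $\operatorname{core}(n)$ denotes the unique squarefree integer (with the sign of $n$) such that $n/\operatorname{core}(n)$ is a perfect square; $\operatorname{core}(1)=1$. For a prime $p$ and nonzero rational $x$, $v_p(x)$ denotes the $p$-adic valuation of $x$. -}

module Defs where

open import Data.Nat as ℕ using (ℕ; zero; suc)
import Data.Nat.GCD as ℕG
open import Data.Integer as ℤ using (ℤ; +_; -[1+_]; ∣_∣; _%ℕ_; _⊓_)
open import Data.Rational as ℚ using (ℚ; 0ℚ; 1ℚ; ½; ↥_; ↧ₙ_)
open import Data.Product using (_×_; _,_; ∃)
open import Data.Sum using (_⊎_)
open import Relation.Binary.PropositionalEquality using (_≡_)
open import Relation.Nullary using (¬_)
open import Data.Nat.Divisibility using (_∣_)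

-- the rational n / m (with the junk value 0 when m = 0)
frac : ℤ → ℕ → ℚ
frac n zero    = 0ℚ
frac n (suc m) = n ℚ./ suc m

powℚ : ℚ → ℕ → ℚ
powℚ q zero    = 1ℚ
powℚ q (suc n) = q ℚ.* powℚ q n

pow2ℤ : ℤ → ℚ
pow2ℤ (+ n)    = powℚ (frac (+ 2) 1) n
pow2ℤ -[1+ n ] = powℚ ½ (suc n)

-- v₂ on positive naturals (fuel = n suffices); v2ℕ 0 = 0 (junk)
v2aux : ℕ → ℕ → ℕ
v2aux zero    n       = 0
v2aux (suc f) zero    = 0
v2aux (suc f) (suc m) with suc m ℕ.% 2
... | zero  = suc (v2aux f (suc m ℕ./ 2))
... | suc _ = 0

v2ℕ : ℕ → ℕ
v2ℕ n = v2aux n n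

v2ℚ : ℚ → ℤ
v2ℚ q = + v2ℕ ∣ ↥ q ∣ ℤ.- + v2ℕ (↧ₙ q)

-- Q(√d) for a fixed d, elements x + y √d as pairs (x , y)

QD : Set
QD = ℚ × ℚ

mulQD : ℤ → QD → QD → QD
mulQD d (x₁ , y₁) (x₂ , y₂) =
  (x₁ ℚ.* x₂ ℚ.+ frac d 1 ℚ.* y₁ ℚ.* y₂ , x₁ ℚ.* y₂ ℚ.+ y₁ ℚ.* x₂)

powQD : ℤ → QD → ℕ → QD
powQD d z zero    = (1ℚ , 0ℚ)
powQD d z (suc n) = mulQD d z (powQD d z n)

normQD : ℤ → QD → ℚ
normQD d (x , y) = x ℚ.* x ℚ.- frac d 1 ℚ.* y ℚ.* y

-- ε = (t + u √d)/2 with t, u integers is an algebraic integer of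
-- Q(√d) (trace t ∈ ℤ) and it is a unit of the ring of integers iff its
-- norm is ±1.
IsUnitOK : ℕ → ℕ → ℕ → Set
IsUnitOK d t u =
  let ε = (frac (+ t) 2 , frac (+ u) 2) in
  (normQD (+ d) ε ≡ 1ℚ) ⊎ (normQD (+ d) ε ≡ ℚ.- 1ℚ)

-- x + y √d = α ε^(2k), k ∈ ℤ.  For k < 0 this is expressed as
-- (x + y√d) ε^(2|k|) = α (equivalent, as ε is invertible).
IsXY : ℤ → QD → QD → ℤ → QD → Set
IsXY d α ε (+ n)    xy = xy ≡ mulQD d α (powQD d ε (2 ℕ.* n))
IsXY d α ε -[1+ n ] xy = mulQD d xy (powQD d ε (2 ℕ.* suc n)) ≡ α

Squarefree : ℤ → Set
Squarefree c = (c ≡ + 0 → Data.Empty.⊥) × (∀ (m : ℕ) → (m ℕ.* m) ∣ ∣ c ∣ → m ≡ 1)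
  where import Data.Empty

IsCore : ℤ → ℤ → Set
IsCore n c =
  Squarefree c × (n ℤ.< + 0 → c ℤ.< + 0) × (+ 0 ℤ.< n → + 0 ℤ.< c)
  × ∃ (λ (m : ℤ) → n ≡ c ℤ.* (m ℤ.* m))

g3aux : ℕ → ℕ → ℕ
g3aux 1 0 = 1
g3aux 3 0 = 2
g3aux _ _ = 4

g3 : ℤ → ℤ → ℕ
g3 t' w = g3aux (t' %ℕ 4) (w %ℕ 2)

-- Write |u₂| = A g₁ and |t'| = B g₂.  Then u₂² t' g₃ = -(g₁² g₂)(A² B g₃), so d' = -D for the
-- positive integer D = A² B g₃, and (|g| 𝒩)² = g₁² g₂ 2^min(v₂ D, 6) / g₃.  Since t' is squarefree
-- and u₂² t' = 4 Nα, u₂ is even; so is u₁ = 2 x, hence 2 ∣ g₁ and g₁² g₂ ≥ 4.  As g₃ ∈ {1, 2, 4}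
-- divides D, g₃ ≤ 2^min(v₂ D, 6), which gives the lower bound.  For the upper bound,
-- 2^min(v₂ D, 6) ≤ D and g₁² g₂ D = u₂² |t'| g₃ = 4 |Nα| g₃.
module Submission where

open import Defs
open import Data.Nat as ℕ using (ℕ; zero; suc; z≤n; s≤s; NonZero)
import Data.Nat.Properties as ℕP
import Data.Nat.GCD as ℕG
open import Data.Nat.Divisibility
open import Data.Nat.DivMod using (m≡m%n+[m/n]*n; m%n<n; m/n<m; m*[n/m]≡n)
open import Data.Nat.Tactic.RingSolver using (solve-∀)
import Data.Nat.Coprimality as Coprime
open import Data.Integer as ℤ using (ℤ; +_; -[1+_]; ∣_∣; _⊓_)
import Data.Integer.Properties as ℤP
open import Data.Rational as ℚ using (ℚ; mkℚ)
import Data.Rational.Properties as ℚP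
import Data.Rational.Unnormalised as ℚᵘ
open ℚᵘ using (mkℚᵘ; *≡*; *≤*)
import Data.Rational.Unnormalised.Properties as ℚᵘP
open import Data.Product using (_,_; ∃; _×_; proj₁; proj₂)
open import Function using (it)
open import Relation.Binary.PropositionalEquality
  using (_≡_; _≢_; refl; sym; trans; cong; cong₂; subst; subst₂; module ≡-Reasoning)
open import Relation.Nullary using (¬_; contradiction)

n%2≡0⇒2*[n/2]≡n : ∀ {n} → n ℕ.% 2 ≡ 0 → 2 ℕ.* (n ℕ./ 2) ≡ n
n%2≡0⇒2*[n/2]≡n {n} even = m*[n/m]≡n (m%n≡0⇒n∣m n 2 even)

2^v2aux∣ : ∀ f n → 2 ℕ.^ v2aux f n ∣ n
2^v2aux∣ zero    n       = 1∣ n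
2^v2aux∣ (suc f) zero    = 1∣ 0
2^v2aux∣ (suc f) (suc m) with suc m ℕ.% 2 in even
... | zero  = subst (2 ℕ.^ suc (v2aux f (suc m ℕ./ 2)) ∣_) (n%2≡0⇒2*[n/2]≡n even)
                (*-monoʳ-∣ 2 (2^v2aux∣ f (suc m ℕ./ 2)))
... | suc _ = 1∣ suc m

j≤v2aux : ∀ j f n .{{_ : NonZero n}} → n ℕ.≤ f → 2 ℕ.^ j ∣ n → j ℕ.≤ v2aux f n
j≤v2aux zero    f       n       _   _       = z≤n
j≤v2aux (suc j) zero    (suc m) ()  _
j≤v2aux (suc j) (suc f) (suc m) n≤f 2^j+1∣n with suc m ℕ.% 2 in even
... | zero  = s≤s (j≤v2aux j f h {{h≢0}} h≤f 2^j∣h)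
  where
  h = suc m ℕ./ 2
  h≢0 : NonZero h
  h≢0 = ℕP.m*n≢0⇒n≢0 2 {{subst NonZero (sym (n%2≡0⇒2*[n/2]≡n even)) it}}
  h≤f : h ℕ.≤ f
  h≤f = ℕP.≤-pred (ℕP.<-≤-trans (m/n<m (suc m) 2 (s≤s (s≤s z≤n))) n≤f)
  2^j∣h : 2 ℕ.^ j ∣ h
  2^j∣h = *-cancelˡ-∣ 2 (subst (2 ℕ.^ suc j ∣_) (sym (n%2≡0⇒2*[n/2]≡n even)) 2^j+1∣n)
... | suc _ = contradiction (trans (sym even) (n∣m⇒m%n≡0 (suc m) 2 (m*n∣⇒m∣ 2 (2 ℕ.^ j) 2^j+1∣n))) λ ()

2^v2ℕ[n]∣n : ∀ n → 2 ℕ.^ v2ℕ n ∣ n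
2^v2ℕ[n]∣n n = 2^v2aux∣ n n

2^j∣n⇒j≤v2ℕ[n] : ∀ {j n} .{{_ : NonZero n}} → 2 ℕ.^ j ∣ n → j ℕ.≤ v2ℕ n
2^j∣n⇒j≤v2ℕ[n] {j} {n} = j≤v2aux j n n ℕP.≤-refl

2^[v2ℕ[n]⊓c]≤n : ∀ n c .{{_ : NonZero n}} → 2 ℕ.^ (v2ℕ n ℕ.⊓ c) ℕ.≤ n
2^[v2ℕ[n]⊓c]≤n n c = ℕP.≤-trans (ℕP.^-monoʳ-≤ 2 (ℕP.m⊓n≤m (v2ℕ n) c)) (∣⇒≤ (2^v2ℕ[n]∣n n))

2^j∣n⇒2^j≤2^[v2ℕ[n]⊓c] : ∀ {j n c} .{{_ : NonZero n}} → j ℕ.≤ c → 2 ℕ.^ j ∣ n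
  → 2 ℕ.^ j ℕ.≤ 2 ℕ.^ (v2ℕ n ℕ.⊓ c)
2^j∣n⇒2^j≤2^[v2ℕ[n]⊓c] j≤c 2^j∣n = ℕP.^-monoʳ-≤ 2 (ℕP.⊓-glb (2^j∣n⇒j≤v2ℕ[n] 2^j∣n) j≤c)

frac-cong : ∀ {i j m n} .{{_ : NonZero m}} .{{_ : NonZero n}}
  → i ℤ.* + n ≡ j ℤ.* + m → frac i m ≡ frac j n
frac-cong {i} {j} {suc m} {suc n} eq = ℚP.fromℚᵘ-cong {mkℚᵘ i m} {mkℚᵘ j n} (*≡* eq)

toℚᵘ-frac : ∀ i m .{{_ : NonZero m}} → ℚ.toℚᵘ (frac i m) ℚᵘ.≃ mkℚᵘ i (ℕ.pred m)
toℚᵘ-frac i (suc m) = ℚP.toℚᵘ-fromℚᵘ (mkℚᵘ i m)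

frac-* : ∀ i j m n .{{_ : NonZero m}} .{{_ : NonZero n}}
  → frac i m ℚ.* frac j n ≡ frac (i ℤ.* j) (m ℕ.* n)
frac-* i j m@(suc _) n@(suc _) = ℚP.toℚᵘ-injective (begin
  ℚ.toℚᵘ (frac i m ℚ.* frac j n)                ≈⟨ ℚP.toℚᵘ-homo-* (frac i m) (frac j n) ⟩
  ℚ.toℚᵘ (frac i m) ℚᵘ.* ℚ.toℚᵘ (frac j n)      ≈⟨ ℚᵘP.*-cong (toℚᵘ-frac i m) (toℚᵘ-frac j n) ⟩
  mkℚᵘ (i ℤ.* j) (ℕ.pred (m ℕ.* n))             ≈⟨ ℚᵘP.≃-sym (toℚᵘ-frac (i ℤ.* j) (m ℕ.* n)) ⟩
  ℚ.toℚᵘ (frac (i ℤ.* j) (m ℕ.* n))             ∎)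
  where open ℚᵘP.≃-Reasoning

pow2ℤ-+ : ∀ e → pow2ℤ (+ e) ≡ frac (+ (2 ℕ.^ e)) 1
pow2ℤ-+ zero    = refl
pow2ℤ-+ (suc e) = begin
  frac (+ 2) 1 ℚ.* pow2ℤ (+ e)             ≡⟨ cong (frac (+ 2) 1 ℚ.*_) (pow2ℤ-+ e) ⟩
  frac (+ 2) 1 ℚ.* frac (+ (2 ℕ.^ e)) 1    ≡⟨ frac-* (+ 2) (+ (2 ℕ.^ e)) 1 1 ⟩
  frac (+ 2 ℤ.* + (2 ℕ.^ e)) 1             ≡⟨ cong (λ i → frac i 1) (ℤP.pos-* 2 (2 ℕ.^ e)) ⟨
  frac (+ (2 ℕ.^ suc e)) 1                 ∎
  where open ≡-Reasoning

frac-*-pow2ℤ : ∀ p q e .{{_ : NonZero q}} → frac (+ p) q ℚ.* pow2ℤ (+ e) ≡ frac (+ (p ℕ.* 2 ℕ.^ e)) q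
frac-*-pow2ℤ p q e = begin
  frac (+ p) q ℚ.* pow2ℤ (+ e)             ≡⟨ cong (frac (+ p) q ℚ.*_) (pow2ℤ-+ e) ⟩
  frac (+ p) q ℚ.* frac (+ (2 ℕ.^ e)) 1    ≡⟨ frac-* (+ p) (+ (2 ℕ.^ e)) q 1 ⟩
  frac (+ p ℤ.* + (2 ℕ.^ e)) (q ℕ.* 1)     ≡⟨ frac-cong {{ℕP.m*n≢0 q 1}} eq ⟩
  frac (+ (p ℕ.* 2 ℕ.^ e)) q               ∎
  where
  open ≡-Reasoning
  eq : + p ℤ.* + (2 ℕ.^ e) ℤ.* + q ≡ + (p ℕ.* 2 ℕ.^ e) ℤ.* + (q ℕ.* 1)
  eq = cong₂ ℤ._*_ (sym (ℤP.pos-* p (2 ℕ.^ e))) (cong +_ (sym (ℕP.*-identityʳ q)))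

frac-mono-≤ : ∀ {a b c d} .{{_ : NonZero b}} .{{_ : NonZero d}}
  → a ℕ.* d ℕ.≤ c ℕ.* b → frac (+ a) b ℚ.≤ frac (+ c) d
frac-mono-≤ {a} {b@(suc _)} {c} {d@(suc _)} ad≤cb = ℚP.toℚᵘ-cancel-≤
  (ℚᵘP.≤-respˡ-≃ (ℚᵘP.≃-sym (toℚᵘ-frac (+ a) b))
  (ℚᵘP.≤-respʳ-≃ (ℚᵘP.≃-sym (toℚᵘ-frac (+ c) d))
  (*≤* (subst₂ ℤ._≤_ (ℤP.pos-* a d) (ℤP.pos-* c b) (ℤ.+≤+ ad≤cb)))))

v2ℚ-frac : ∀ i m .{{_ : NonZero m}} → v2ℚ (frac (i ℤ.* + m) m) ≡ + v2ℕ (∣ i ∣)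
v2ℚ-frac i m = begin
  v2ℚ (frac (i ℤ.* + m) m)   ≡⟨ cong v2ℚ (frac-cong {j = i} (ℤP.*-identityʳ (i ℤ.* + m))) ⟩
  v2ℚ (frac i 1)             ≡⟨ cong v2ℚ (ℚP.↥p/↧p≡p i/1) ⟩
  + v2ℕ (∣ i ∣) ℤ.- + 0      ≡⟨ ℤP.+-identityʳ (+ v2ℕ (∣ i ∣)) ⟩
  + v2ℕ (∣ i ∣)              ∎
  where
  open ≡-Reasoning
  i/1 = mkℚ i 0 (Coprime.sym (Coprime.1-coprimeTo (∣ i ∣)))

i<0⇒i≡-∣i∣ : ∀ {i} → i ℤ.< + 0 → i ≡ ℤ.- + ∣ i ∣
i<0⇒i≡-∣i∣ { -[1+ _ ]} _ = refl
i<0⇒i≡-∣i∣ {+ _} (ℤ.+<+ ())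

i<0⇒nonZero∣i∣ : ∀ {i} → i ℤ.< + 0 → NonZero ∣ i ∣
i<0⇒nonZero∣i∣ { -[1+ _ ]} _ = _
i<0⇒nonZero∣i∣ {+ _} (ℤ.+<+ ())

-m*n≡-[m*n] : ∀ m n → ℤ.- + m ℤ.* + n ≡ ℤ.- + (m ℕ.* n)
-m*n≡-[m*n] m n = trans (sym (ℤP.neg-distribˡ-* (+ m) (+ n))) (cong ℤ.-_ (sym (ℤP.pos-* m n)))

≡*⇒nonZero : ∀ {p m n} .{{_ : NonZero p}} → p ≡ m ℕ.* n → NonZero m × NonZero n
≡*⇒nonZero {m = m} p≡mn =
  ℕP.m*n≢0⇒m≢0 m {{subst NonZero p≡mn it}} , ℕP.m*n≢0⇒n≢0 m {{subst NonZero p≡mn it}}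

∣u*u*t∣≡∣u∣*∣u∣*∣t∣ : ∀ u t → ∣ u ℤ.* u ℤ.* t ∣ ≡ ∣ u ∣ ℕ.* ∣ u ∣ ℕ.* ∣ t ∣
∣u*u*t∣≡∣u∣*∣u∣*∣t∣ u t = trans (ℤP.abs-* (u ℤ.* u) t) (cong (ℕ._* ∣ t ∣) (ℤP.abs-* u u))

u*u*t≡4N⇒∣u∣*∣u∣*∣t∣≡4∣N∣ : ∀ u t {N} → u ℤ.* u ℤ.* t ≡ + 4 ℤ.* N → ∣ u ∣ ℕ.* ∣ u ∣ ℕ.* ∣ t ∣ ≡ 4 ℕ.* ∣ N ∣
u*u*t≡4N⇒∣u∣*∣u∣*∣t∣≡4∣N∣ u t {N} eq =
  trans (sym (∣u*u*t∣≡∣u∣*∣u∣*∣t∣ u t)) (trans (cong ∣_∣ eq) (ℤP.abs-* (+ 4) N))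

u*u*t≡4N⇒u*u*t≡-∣u∣*∣u∣*∣t∣ : ∀ u t {N} → N ℤ.< + 0 → u ℤ.* u ℤ.* t ≡ + 4 ℤ.* N
  → u ℤ.* u ℤ.* t ≡ ℤ.- + (∣ u ∣ ℕ.* ∣ u ∣ ℕ.* ∣ t ∣)
u*u*t≡4N⇒u*u*t≡-∣u∣*∣u∣*∣t∣ u t {N} N<0 eq = begin
  u ℤ.* u ℤ.* t                        ≡⟨ eq ⟩
  + 4 ℤ.* N                            ≡⟨ cong (+ 4 ℤ.*_) (i<0⇒i≡-∣i∣ N<0) ⟩
  + 4 ℤ.* ℤ.- + ∣ N ∣                  ≡⟨ ℤP.neg-distribʳ-* (+ 4) (+ ∣ N ∣) ⟨
  ℤ.- (+ 4 ℤ.* + ∣ N ∣)                ≡⟨ cong ℤ.-_ (ℤP.pos-* 4 (∣ N ∣)) ⟨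
  ℤ.- + (4 ℕ.* ∣ N ∣)                  ≡⟨ cong (λ m → ℤ.- + m) (u*u*t≡4N⇒∣u∣*∣u∣*∣t∣≡4∣N∣ u t eq) ⟨
  ℤ.- + (∣ u ∣ ℕ.* ∣ u ∣ ℕ.* ∣ t ∣)    ∎
  where open ≡-Reasoning

squarefree-4∣u*u*∣t∣⇒2∣u : ∀ {t} u → Squarefree t → 4 ∣ u ℕ.* u ℕ.* ∣ t ∣ → 2 ∣ u
squarefree-4∣u*u*∣t∣⇒2∣u {t} u (_ , squarefree) 4∣u²t with u ℕ.% 2 in parity | m%n<n u 2
... | 0           | _            = m%n≡0⇒n∣m u 2 parity
... | suc (suc _) | s≤s (s≤s ())
... | 1           | _            = contradiction (squarefree 2 4∣t) λ ()
  where
  q = u ℕ./ 2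
  u-odd : u ≡ 1 ℕ.+ q ℕ.* 2
  u-odd = trans (m≡m%n+[m/n]*n u 2) (cong (ℕ._+ q ℕ.* 2) parity)
  odd-square : ∀ q s → (1 ℕ.+ q ℕ.* 2) ℕ.* (1 ℕ.+ q ℕ.* 2) ℕ.* s ≡ 4 ℕ.* ((q ℕ.+ q ℕ.* q) ℕ.* s) ℕ.+ s
  odd-square = solve-∀
  4∣t : 4 ∣ ∣ t ∣
  4∣t = ∣m+n∣m⇒∣n
    (subst (4 ∣_) (trans (cong (λ w → w ℕ.* w ℕ.* ∣ t ∣) u-odd) (odd-square q (∣ t ∣))) 4∣u²t)
    (m∣m*n ((q ℕ.+ q ℕ.* q) ℕ.* ∣ t ∣))

2∣gcd[∣2x∣,∣u∣] : ∀ x u t {N} → Squarefree t → u ℤ.* u ℤ.* t ≡ + 4 ℤ.* N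
  → 2 ∣ ℕG.gcd (∣ + 2 ℤ.* x ∣) (∣ u ∣)
2∣gcd[∣2x∣,∣u∣] x u t {N} squarefree eq = ℕG.gcd-greatest 2∣∣2x∣ 2∣∣u∣
  where
  2∣∣2x∣ : 2 ∣ ∣ + 2 ℤ.* x ∣
  2∣∣2x∣ = subst (2 ∣_) (sym (ℤP.abs-* (+ 2) x)) (m∣m*n (∣ x ∣))
  2∣∣u∣ : 2 ∣ ∣ u ∣
  2∣∣u∣ = squarefree-4∣u*u*∣t∣⇒2∣u (∣ u ∣) squarefree
    (subst (4 ∣_) (sym (u*u*t≡4N⇒∣u∣*∣u∣*∣t∣≡4∣N∣ u t eq)) (m∣m*n (∣ N ∣)))

g3aux≡2^j : ∀ r s → ∃ λ j → j ℕ.≤ 2 × g3aux r s ≡ 2 ℕ.^ j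
g3aux≡2^j 1 0                         = 0 , z≤n , refl
g3aux≡2^j 3 0                         = 1 , s≤s z≤n , refl
g3aux≡2^j 0 _                         = 2 , ℕP.≤-refl , refl
g3aux≡2^j 1 (suc _)                   = 2 , ℕP.≤-refl , refl
g3aux≡2^j 2 _                         = 2 , ℕP.≤-refl , refl
g3aux≡2^j 3 (suc _)                   = 2 , ℕP.≤-refl , refl
g3aux≡2^j (suc (suc (suc (suc _)))) _ = 2 , ℕP.≤-refl , refl

d'-negative-integer : ∀ u t {N g₁ g₂} g₃ → N ℤ.< + 0 → u ℤ.* u ℤ.* t ≡ + 4 ℤ.* N
  → g₁ ∣ ∣ u ∣ → g₂ ∣ ∣ t ∣
  → ∃ λ D → (u ℤ.* u ℤ.* t ℤ.* + g₃ ≡ ℤ.- + D ℤ.* + (g₁ ℕ.* g₁ ℕ.* g₂))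
          × (g₁ ℕ.* g₁ ℕ.* g₂ ℕ.* D ≡ 4 ℕ.* ∣ N ∣ ℕ.* g₃) × (g₃ ∣ D)
d'-negative-integer u t {N} {g₁} {g₂} g₃ N<0 eq (divides A ∣u∣≡Ag₁) (divides B ∣t∣≡Bg₂) =
  D , numerator , KD≡4∣N∣g₃ , n∣m*n (A ℕ.* A ℕ.* B)
  where
  open ≡-Reasoning
  K = g₁ ℕ.* g₁ ℕ.* g₂
  D = A ℕ.* A ℕ.* B ℕ.* g₃
  regroup : ∀ a b g h c → a ℕ.* g ℕ.* (a ℕ.* g) ℕ.* (b ℕ.* h) ℕ.* c ≡ g ℕ.* g ℕ.* h ℕ.* (a ℕ.* a ℕ.* b ℕ.* c)
  regroup = solve-∀
  u²tg₃≡KD : ∣ u ∣ ℕ.* ∣ u ∣ ℕ.* ∣ t ∣ ℕ.* g₃ ≡ K ℕ.* D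
  u²tg₃≡KD = trans (cong₂ (λ p q → p ℕ.* p ℕ.* q ℕ.* g₃) ∣u∣≡Ag₁ ∣t∣≡Bg₂) (regroup A B g₁ g₂ g₃)
  KD≡4∣N∣g₃ : K ℕ.* D ≡ 4 ℕ.* ∣ N ∣ ℕ.* g₃
  KD≡4∣N∣g₃ = trans (sym u²tg₃≡KD) (cong (ℕ._* g₃) (u*u*t≡4N⇒∣u∣*∣u∣*∣t∣≡4∣N∣ u t eq))
  numerator : u ℤ.* u ℤ.* t ℤ.* + g₃ ≡ ℤ.- + D ℤ.* + K
  numerator = begin
    u ℤ.* u ℤ.* t ℤ.* + g₃                      ≡⟨ cong (ℤ._* + g₃) (u*u*t≡4N⇒u*u*t≡-∣u∣*∣u∣*∣t∣ u t N<0 eq) ⟩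
    ℤ.- + (∣ u ∣ ℕ.* ∣ u ∣ ℕ.* ∣ t ∣) ℤ.* + g₃    ≡⟨ -m*n≡-[m*n] (∣ u ∣ ℕ.* ∣ u ∣ ℕ.* ∣ t ∣) g₃ ⟩
    ℤ.- + (∣ u ∣ ℕ.* ∣ u ∣ ℕ.* ∣ t ∣ ℕ.* g₃)      ≡⟨ cong (λ m → ℤ.- + m) (trans u²tg₃≡KD (ℕP.*-comm K D)) ⟩
    ℤ.- + (D ℕ.* K)                             ≡⟨ -m*n≡-[m*n] D K ⟨
    ℤ.- + D ℤ.* + K                             ∎

K*2^[v2ℕ[D]⊓6]-bounds : ∀ {K D g j N} .{{_ : NonZero D}} → 4 ℕ.≤ K → j ℕ.≤ 6 → g ≡ 2 ℕ.^ j → g ∣ D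
  → K ℕ.* D ≡ N ℕ.* g
  → (4 ℕ.* g ℕ.≤ K ℕ.* 2 ℕ.^ (v2ℕ D ℕ.⊓ 6)) × (K ℕ.* 2 ℕ.^ (v2ℕ D ℕ.⊓ 6) ℕ.≤ N ℕ.* g)
K*2^[v2ℕ[D]⊓6]-bounds {K} {D} 4≤K j≤6 refl g∣D KD≡Ng =
  ℕP.*-mono-≤ 4≤K (2^j∣n⇒2^j≤2^[v2ℕ[n]⊓c] j≤6 g∣D) ,
  ℕP.≤-trans (ℕP.*-monoʳ-≤ K (2^[v2ℕ[n]⊓c]≤n D 6)) (ℕP.≤-reflexive KD≡Ng)

frac-*-pow2ℤ-bounds : ∀ {K q e N} .{{_ : NonZero q}} → 4 ℕ.* q ℕ.≤ K ℕ.* 2 ℕ.^ e → K ℕ.* 2 ℕ.^ e ℕ.≤ N ℕ.* q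
  → (frac (+ 4) 1 ℚ.≤ frac (+ K) q ℚ.* pow2ℤ (+ e)) × (frac (+ K) q ℚ.* pow2ℤ (+ e) ℚ.≤ frac (+ N) 1)
frac-*-pow2ℤ-bounds {K} {q} {e} {N} lower upper =
  subst (λ P → (frac (+ 4) 1 ℚ.≤ P) × (P ℚ.≤ frac (+ N) 1)) (sym (frac-*-pow2ℤ K q e))
    ( frac-mono-≤ {4} {1} {K ℕ.* 2 ℕ.^ e} {q} (subst (4 ℕ.* q ℕ.≤_) (sym (ℕP.*-identityʳ _)) lower)
    , frac-mono-≤ {K ℕ.* 2 ℕ.^ e} {q} {N} {1} (subst (ℕ._≤ N ℕ.* q) (sym (ℕP.*-identityʳ _)) upper))

lemma3p5 : (a b d : ℕ) → 0 ℕ.< a → 0 ℕ.< b → 0 ℕ.< d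
  → ¬ (∃ λ (m : ℕ) → m ℕ.* m ≡ d)
  → (t u : ℕ) → 0 ℕ.< t → 0 ℕ.< u → IsUnitOK d t u
  → (k : ℤ) → k ≢ + 0
  → (Nα : ℤ) → Nα ≡ + a ℤ.* + a ℤ.- + (b ℕ.^ 4) ℤ.* + d → Nα ℤ.< + 0
  → (x y : ℤ)
  → IsXY (+ d) (frac (+ a) 1 , frac (+ (b ℕ.* b)) 1) (frac (+ t) 2 , frac (+ u) 2) k (frac x 1 , frac y 1)
  → (t' : ℤ) → IsCore Nα t'
  → (u₁ u₂ : ℤ) → u₁ ≡ + 2 ℤ.* x → u₂ ℤ.* u₂ ℤ.* t' ≡ + 4 ℤ.* Nα
  → (g₁ : ℕ) → g₁ ≡ ℕG.gcd ∣ u₁ ∣ ∣ u₂ ∣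
  → (v w : ℤ) → v ℤ.* + g₁ ≡ u₁ → w ℤ.* + g₁ ≡ u₁ ℤ.- u₂
  → (g₂ : ℕ) → g₂ ≡ ℕG.gcd ∣ v ∣ ∣ t' ∣
  → (g₃ : ℕ) → g₃ ≡ g3 t' w
  → (d' : ℚ) → d' ≡ frac (u₂ ℤ.* u₂ ℤ.* t' ℤ.* + g₃) (g₁ ℕ.* g₁ ℕ.* g₂)
  → let gsq = frac (+ (g₁ ℕ.* g₁ ℕ.* g₂)) g₃
        Nsq = pow2ℤ (v2ℚ d' ⊓ + 6)
        P   = gsq ℚ.* Nsq
    in (frac (+ 4) 1 ℚ.≤ P) × (P ℚ.≤ frac (+ 4 ℤ.* + ∣ Nα ∣) 1)
lemma3p5 _ _ _ _ _ _ _ _ _ _ _ _ _ _ Nα _ Nα<0 x _ _ t' (squarefree , _) u₁ u₂ refl u₂²t'≡4Nα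
         g₁ refl v w _ _ g₂ refl g₃ refl d' refl
  with g3aux≡2^j (t' ℤ.%ℕ 4) (w ℤ.%ℕ 2)
     | d'-negative-integer u₂ t' g₃ Nα<0 u₂²t'≡4Nα
         (ℕG.gcd[m,n]∣n (∣ u₁ ∣) (∣ u₂ ∣)) (ℕG.gcd[m,n]∣n (∣ v ∣) (∣ t' ∣))
... | j , j≤2 , g₃≡2^j | D , numerator , KD≡4ng₃ , g₃∣D =
  subst₂ (λ z M → (frac (+ 4) 1 ℚ.≤ P z) × (P z ℚ.≤ frac M 1)) (sym v2ℚ[d']≡v2ℕ[D]) (ℤP.pos-* 4 n)
    (frac-*-pow2ℤ-bounds {K} {g₃} {v2ℕ D ℕ.⊓ 6} {4 ℕ.* n} (proj₁ bounds) (proj₂ bounds))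
  where
  n = ∣ Nα ∣
  K = g₁ ℕ.* g₁ ℕ.* g₂
  P : ℤ → ℚ
  P z = frac (+ K) g₃ ℚ.* pow2ℤ (z ⊓ + 6)
  instance
    n≢0 : NonZero n
    n≢0 = i<0⇒nonZero∣i∣ Nα<0
    g₃≢0 : NonZero g₃
    g₃≢0 = subst NonZero (sym g₃≡2^j) (ℕP.m^n≢0 2 j)
  K≢0×D≢0 : NonZero K × NonZero D
  K≢0×D≢0 = ≡*⇒nonZero {{ℕP.m*n≢0 (4 ℕ.* n) g₃ {{ℕP.m*n≢0 4 n}}}} (sym KD≡4ng₃)
  4∣K : 4 ∣ K
  4∣K = ∣-trans (*-pres-∣ 2∣g₁ 2∣g₁) (m∣m*n g₂)
    where 2∣g₁ = 2∣gcd[∣2x∣,∣u∣] x u₂ t' squarefree u₂²t'≡4Nα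
  bounds : (4 ℕ.* g₃ ℕ.≤ K ℕ.* 2 ℕ.^ (v2ℕ D ℕ.⊓ 6)) × (K ℕ.* 2 ℕ.^ (v2ℕ D ℕ.⊓ 6) ℕ.≤ 4 ℕ.* n ℕ.* g₃)
  bounds = K*2^[v2ℕ[D]⊓6]-bounds {N = 4 ℕ.* n} {{proj₂ K≢0×D≢0}} (∣⇒≤ {{proj₁ K≢0×D≢0}} 4∣K)
             (ℕP.≤-trans j≤2 (ℕP.m≤m+n 2 4)) g₃≡2^j g₃∣D KD≡4ng₃
  v2ℚ[d']≡v2ℕ[D] : v2ℚ d' ≡ + v2ℕ D
  v2ℚ[d']≡v2ℕ[D] = trans (cong (λ i → v2ℚ (frac i K)) numerator)
    (trans (v2ℚ-frac (ℤ.- + D) K {{proj₁ K≢0×D≢0}}) (cong (λ m → + v2ℕ m) (ℤP.∣-i∣≡∣i∣ (+ D))))
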